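{- Let $G$ be a finite connected graph of order $n$ with minimum degree $\delta \geq 2$, and let $\rho(G)$ denote its packing number. Then $$\gamma_{s}(G)\leq n-2\left\lfloor\frac{2\rho(G)+\delta-2}{2}\right\rfloor .$$ Moreover, the bound is sharp: for every $n\geq 3$ equality holds for the complete graph $K_n$.
   Context: A set $B\subseteq V(G)$ is a packing if $N[u]\cap N[v]=\emptyset$ for all distinct $u,v\in B$, where $N[v]$ is the closed neighborhood of $v$; $\rho(G)$ is the maximum cardinality of a packing. A signed dominating function (SDF) of $G$ is a function $f:V(G)\to\{ -1,1\}$ with $f(N[v])=\sum_{u\in N[v]}f(u)\geq 1$ for every vertex $v$. The signed domination number $\gamma_s(G)$ is the minimum of $f(V(G))=\sum_{v\in V(G)} f(v)$ over all SDFs $f$ of $G$. -}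

module Defs where

open import Data.Bool using (Bool; true; false; if_then_else_; _∨_)
open import Data.Nat using (ℕ; _≤_; _+_; _*_; _∸_; _/_)
open import Data.Integer as ℤ using (ℤ; +_; -_)
open import Data.Fin using (Fin; _≟_)
open import Data.List using (List; []; _∷_; map; allFin)
import Data.List as L
open import Data.Nat.ListAction using () renaming (sum to sumℕ)
open import Data.Product using (Σ; ∃; _×_; _,_)
open import Data.Sum using (_⊎_)
open import Relation.Binary.PropositionalEquality using (_≡_; _≢_)
open import Relation.Nullary using (¬_)
open import Relation.Nullary.Decidable using (⌊_⌋)

record Graph (n : ℕ) : Set where
  field
    Adj    : Fin n → Fin n → Bool
    adj-sym    : ∀ u v → Adj u v ≡ Adj v u
    adj-irrefl : ∀ v → Adj v v ≡ false
open Graph public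

count : {n : ℕ} → (Fin n → Bool) → ℕ
count {n} p = sumℕ (map (λ i → if p i then 1 else 0) (allFin n))

sumℤ : {n : ℕ} → (Fin n → Bool) → (Fin n → ℤ) → ℤ
sumℤ {n} p f = L.foldr ℤ._+_ (+ 0) (map (λ i → if p i then f i else + 0) (allFin n))

inN : {n : ℕ} → Graph n → Fin n → Fin n → Bool
inN G v u = ⌊ v ≟ u ⌋ ∨ Adj G v u

degree : {n : ℕ} → Graph n → Fin n → ℕ
degree G v = count (Adj G v)

IsMinDegree : {n : ℕ} → Graph n → ℕ → Set
IsMinDegree G δ = (∃ λ v → degree G v ≡ δ) × (∀ v → δ ≤ degree G v)

data Reach {n : ℕ} (G : Graph n) : Fin n → Fin n → Set where
  here : ∀ {v} → Reach G v v
  step : ∀ {u v w} → Adj G u v ≡ true → Reach G v w → Reach G u w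

Connected : {n : ℕ} → Graph n → Set
Connected G = ∀ u v → Reach G u v

IsPacking : {n : ℕ} → Graph n → (Fin n → Bool) → Set
IsPacking G B = ∀ u v → B u ≡ true → B v ≡ true → u ≢ v →
  ∀ w → ¬ (inN G u w ≡ true × inN G v w ≡ true)

IsPackingNumber : {n : ℕ} → Graph n → ℕ → Set
IsPackingNumber G ρ =
  (Σ _ λ B → IsPacking G B × count B ≡ ρ) × (∀ B → IsPacking G B → count B ≤ ρ)

IsSDF : {n : ℕ} → Graph n → (Fin n → ℤ) → Set
IsSDF G f = (∀ v → f v ≡ + 1 ⊎ f v ≡ - (+ 1)) × (∀ v → + 1 ℤ.≤ sumℤ (inN G v) f)

weight : {n : ℕ} → (Fin n → ℤ) → ℤ
weight f = sumℤ (λ _ → true) f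

IsSignedDomNumber : {n : ℕ} → Graph n → ℤ → Set
IsSignedDomNumber G γ =
  (Σ _ λ f → IsSDF G f × weight f ≡ γ) × (∀ f → IsSDF G f → γ ℤ.≤ weight f)

-- the bound  n - 2 ⌊(2ρ + δ - 2)/2⌋  (for δ ≥ 2 the numerator is a natural number)
bound : ℕ → ℕ → ℕ → ℤ
bound n ρ δ = + n ℤ.- + (2 * ((2 * ρ + δ ∸ 2) / 2))

complete : (n : ℕ) → Graph n
complete n = record
  { Adj = λ u v → if ⌊ u ≟ v ⌋ then false else true
  ; adj-sym = symK
  ; adj-irrefl = irrK }
  where
  open import Relation.Binary.PropositionalEquality using (refl; sym)
  open import Data.Empty using (⊥-elim)
  open import Relation.Nullary using (yes; no)
  symK : ∀ (u v : Fin n) → (if ⌊ u ≟ v ⌋ then false else true) ≡ (if ⌊ v ≟ u ⌋ then false else true)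
  symK u v with u ≟ v | v ≟ u
  ... | yes _ | yes _ = refl
  ... | no _  | no _  = refl
  ... | yes p | no q  = ⊥-elim (q (sym p))
  ... | no p  | yes q = ⊥-elim (p (sym q))
  irrK : ∀ (v : Fin n) → (if ⌊ v ≟ v ⌋ then false else true) ≡ false
  irrK v with v ≟ v
  ... | yes _ = refl
  ... | no p  = ⊥-elim (p refl)

-- A maximum packing B is extended by a set T of ⌊(δ-2)/2⌋ neighbours of one of its vertices; T avoids B
-- because B is a packing. Assigning -1 exactly on B ∪ T gives a signed dominating function: a closed
-- neighbourhood contains at most one vertex of B and at most |T| of T, hence at most ⌊δ/2⌋ negative
-- entries among its at least δ + 1 entries. Its weight n - 2(ρ + ⌊(δ-2)/2⌋) is the bound. In K_n every
-- closed neighbourhood is the whole vertex set, so ρ = 1 and a signed dominating function has at most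
-- ⌊(n-1)/2⌋ = ⌊δ/2⌋ negative vertices, which is the reverse inequality.
module Submission where

open import Defs
open import Data.Nat using (ℕ; _≤_)
open import Data.Integer using (ℤ) renaming (_≤_ to _≤ℤ_)
open import Data.Product using (_×_)
open import Relation.Binary.PropositionalEquality using (_≡_)

open import Data.Bool using (Bool; true; false; if_then_else_; _∨_; _∧_)
import Data.Bool.Properties as Boolₚ
open import Data.Fin using (Fin; zero; suc; _≟_)
import Data.Fin.Properties as Fin
open import Data.Integer using (+_; -_; +≤+) renaming (_+_ to _+ℤ_; _-_ to _-ℤ_; _≟_ to _≟ℤ_)
import Data.Integer.Properties as ℤₚ
open import Data.Integer.Tactic.RingSolver using (solve-∀)
open import Data.List as List using (allFin; map; foldr)
import Data.List.Properties as Listₚ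
open import Data.Nat using (zero; suc; _+_; _*_; _∸_; _/_; _<_; _<?_; z≤n; s≤s)
open import Data.Nat.Divisibility using (m∣m*n)
open import Data.Nat.DivMod using (m/n*n≤m; m*n/n≡m; +-distrib-/-∣ˡ; /-monoˡ-≤; m/n≡1+[m∸n]/n)
open import Data.Nat.ListAction using () renaming (sum to sumℕ)
open import Data.Nat.Properties hiding (_≟_)
open import Data.Product using (Σ; ∃; _,_; proj₁)
open import Data.Sum using (_⊎_; inj₁; inj₂)
open import Data.Vec.Functional using (_∷_)
open import Function using (_∘_; id)
open import Function.Bundles using (_⇔_; mk⇔; Equivalence)
open import Relation.Binary.PropositionalEquality using (refl; sym; trans; cong; cong₂; subst; subst₂; _≢_; module ≡-Reasoning)
open import Relation.Nullary using (yes; no; contradiction)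
open import Relation.Nullary.Decidable using (⌊_⌋; toWitness; fromWitness)

private variable n : ℕ

_⊆_ : (p q : Fin n → Bool) → Set
p ⊆ q = ∀ u → p u ≡ true → q u ≡ true

indicator : Bool → ℕ
indicator b = if b then 1 else 0

map-allFin-suc : ∀ {A : Set} (f : Fin (suc n) → A) →
  map f (allFin (suc n)) ≡ f zero List.∷ map (f ∘ suc) (allFin n)
map-allFin-suc f = cong (f zero List.∷_)
  (trans (Listₚ.map-tabulate suc f) (sym (Listₚ.map-tabulate id (f ∘ suc))))

count-suc : (p : Fin (suc n) → Bool) → count p ≡ indicator (p zero) + count (p ∘ suc)
count-suc p = cong sumℕ (map-allFin-suc (indicator ∘ p))

count-cong : {p q : Fin n → Bool} → (∀ u → p u ≡ q u) → count p ≡ count q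
count-cong p≗q = cong sumℕ (Listₚ.map-cong (cong indicator ∘ p≗q) (allFin _))

count-true : count {n} (λ _ → true) ≡ n
count-true {zero}  = refl
count-true {suc n} = trans (count-suc {n = n} (λ _ → true)) (cong suc (count-true {n}))

count-none : (p : Fin n → Bool) → (∀ u → p u ≡ false) → count p ≡ 0
count-none {zero}  p none = refl
count-none {suc n} p none rewrite count-suc p | none zero = count-none (p ∘ suc) (none ∘ suc)

count-mono : {p q : Fin n → Bool} → p ⊆ q → count p ≤ count q
count-mono {zero}  p⊆q = z≤n
count-mono {suc n} {p} {q} p⊆q
  rewrite count-suc p | count-suc q with p zero in p₀ | q zero in q₀
... | true  | true  = s≤s (count-mono (p⊆q ∘ suc))
... | true  | false with () ← trans (sym (p⊆q zero p₀)) q₀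
... | false | true  = m≤n⇒m≤1+n (count-mono (p⊆q ∘ suc))
... | false | false = count-mono (p⊆q ∘ suc)

count-∨-∧ : (p q : Fin n → Bool) →
  count (λ u → p u ∨ q u) + count (λ u → p u ∧ q u) ≡ count p + count q
count-∨-∧ {zero}  p q = refl
count-∨-∧ {suc n} p q
  rewrite count-suc (λ u → p u ∨ q u) | count-suc (λ u → p u ∧ q u)
        | count-suc p | count-suc q
  with p zero | q zero | count-∨-∧ (p ∘ suc) (q ∘ suc)
... | true  | true  | ih = cong suc (trans (+-suc _ _) (trans (cong suc ih) (sym (+-suc _ _))))
... | true  | false | ih = cong suc ih
... | false | true  | ih = trans (cong suc ih) (sym (+-suc _ _))
... | false | false | ih = ih

count-∨-≤ : (p q : Fin n → Bool) → count (λ u → p u ∨ q u) ≤ count p + count q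
count-∨-≤ p q = ≤-trans (m≤m+n _ _) (≤-reflexive (count-∨-∧ p q))

count-∨-disjoint : (p q : Fin n → Bool) → (∀ u → p u ∧ q u ≡ false) →
  count (λ u → p u ∨ q u) ≡ count p + count q
count-∨-disjoint p q disjoint = begin
  count (λ u → p u ∨ q u)                          ≡⟨ +-identityʳ _ ⟨
  count (λ u → p u ∨ q u) + 0                      ≡⟨ cong₂ _+_ refl (count-none _ disjoint) ⟨
  count (λ u → p u ∨ q u) + count (λ u → p u ∧ q u) ≡⟨ count-∨-∧ p q ⟩
  count p + count q                                ∎
  where open ≡-Reasoning

count-≤1 : (p : Fin n → Bool) → (∀ u w → p u ≡ true → p w ≡ true → u ≡ w) → count p ≤ 1
count-≤1 {zero}  p unique = z≤n
count-≤1 {suc n} p unique rewrite count-suc p with p zero in p₀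
... | true  = s≤s (≤-reflexive (count-none (p ∘ suc) others-false))
  where
  others-false : ∀ u → p (suc u) ≡ false
  others-false u with p (suc u) in pᵤ
  ... | true  with () ← unique (suc u) zero pᵤ p₀
  ... | false = refl
... | false = count-≤1 (p ∘ suc) (λ u w pu pw → Fin.suc-injective (unique (suc u) (suc w) pu pw))

count-≥1 : (p : Fin n → Bool) {v : Fin n} → p v ≡ true → 1 ≤ count p
count-≥1 p {zero}  pv rewrite count-suc p | pv = s≤s z≤n
count-≥1 p {suc v} pv rewrite count-suc p =
  ≤-trans (count-≥1 (p ∘ suc) pv) (m≤n+m _ (indicator (p zero)))

count-≥1⇒∃ : (p : Fin n → Bool) → 1 ≤ count p → ∃ λ u → p u ≡ true
count-≥1⇒∃ {zero}  p ()
count-≥1⇒∃ {suc n} p h rewrite count-suc p with p zero in p₀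
... | true  = zero , p₀
... | false with u , pu ← count-≥1⇒∃ (p ∘ suc) h = suc u , pu

subset-of-count : (p : Fin n → Bool) (k : ℕ) → k ≤ count p →
  Σ (Fin n → Bool) λ q → q ⊆ p × count q ≡ k
subset-of-count {n} p zero _ = (λ _ → false) , (λ _ ()) , count-none {n} (λ _ → false) (λ _ → refl)
subset-of-count {suc n} p (suc k) h rewrite count-suc p with p zero in p₀
... | true  with q , q⊆p , #q ← subset-of-count (p ∘ suc) k (≤-pred h) =
  true ∷ q , (λ { zero _ → p₀ ; (suc u) → q⊆p u }) , trans (count-suc (true ∷ q)) (cong suc #q)
... | false with q , q⊆p , #q ← subset-of-count (p ∘ suc) (suc k) h =
  false ∷ q , (λ { zero () ; (suc u) → q⊆p u }) , trans (count-suc (false ∷ q)) #q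

sumℤ-suc : (p : Fin (suc n) → Bool) (f : Fin (suc n) → ℤ) →
  sumℤ p f ≡ (if p zero then f zero else + 0) +ℤ sumℤ (p ∘ suc) (f ∘ suc)
sumℤ-suc p f = cong (foldr _+ℤ_ (+ 0)) (map-allFin-suc (λ u → if p u then f u else + 0))

sumℤ-cong : {p q : Fin n → Bool} {f g : Fin n → ℤ} →
  (∀ u → p u ≡ q u) → (∀ u → f u ≡ g u) → sumℤ p f ≡ sumℤ q g
sumℤ-cong p≗q f≗g = cong (foldr _+ℤ_ (+ 0))
  (Listₚ.map-cong (λ u → cong₂ (λ b x → if b then x else + 0) (p≗q u) (f≗g u)) (allFin _))

sign : (Fin n → Bool) → Fin n → ℤ
sign S u = if S u then - + 1 else + 1

private
  1+[m-k]≡[1+m]-k : ∀ m k → + 1 +ℤ (m -ℤ k) ≡ (+ 1 +ℤ m) -ℤ k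
  1+[m-k]≡[1+m]-k = solve-∀

  -1+[m-k]≡[1+m]-[2+k] : ∀ m k → - + 1 +ℤ (m -ℤ k) ≡ (+ 1 +ℤ m) -ℤ (+ 2 +ℤ k)
  -1+[m-k]≡[1+m]-[2+k] = solve-∀

sumℤ-sign : (p S : Fin n → Bool) →
  sumℤ p (sign S) ≡ + count p -ℤ + (2 * count (λ u → p u ∧ S u))
sumℤ-sign {zero}  p S = refl
sumℤ-sign {suc n} p S
  rewrite sumℤ-suc p (sign S) | count-suc p | count-suc (λ u → p u ∧ S u)
  with p zero | S zero | sumℤ-sign (p ∘ suc) (S ∘ suc)
... | false | _     | ih = trans (ℤₚ.+-identityˡ _) ih
... | true  | false | ih = trans (cong (+ 1 +ℤ_) ih) (1+[m-k]≡[1+m]-k (+ c) (+ (2 * s)))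
  where
  c = count (p ∘ suc)
  s = count (λ u → p (suc u) ∧ S (suc u))
... | true  | true  | ih = begin
  - + 1 +ℤ sumℤ (p ∘ suc) (sign (S ∘ suc))  ≡⟨ cong (- + 1 +ℤ_) ih ⟩
  - + 1 +ℤ (+ c -ℤ + (2 * s))               ≡⟨ -1+[m-k]≡[1+m]-[2+k] (+ c) (+ (2 * s)) ⟩
  + suc c -ℤ + (2 + 2 * s)                  ≡⟨ cong (λ t → + suc c -ℤ + t) (*-suc 2 s) ⟨
  + suc c -ℤ + (2 * suc s)                  ∎
  where
  open ≡-Reasoning
  c = count (p ∘ suc)
  s = count (λ u → p (suc u) ∧ S (suc u))

weight-sign : (S : Fin n → Bool) → weight (sign S) ≡ + n -ℤ + (2 * count S)
weight-sign {n} S =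
  trans (sumℤ-sign (λ _ → true) S) (cong (λ m → + m -ℤ + (2 * count S)) (count-true {n}))

sign-±1 : (S : Fin n → Bool) → ∀ v → sign S v ≡ + 1 ⊎ sign S v ≡ - + 1
sign-±1 S v with S v
... | true  = inj₂ refl
... | false = inj₁ refl

negatives : (Fin n → ℤ) → Fin n → Bool
negatives f u = ⌊ f u ≟ℤ - + 1 ⌋

±1⇒≗sign-negatives : (f : Fin n → ℤ) → (∀ v → f v ≡ + 1 ⊎ f v ≡ - + 1) →
  ∀ v → f v ≡ sign (negatives f) v
±1⇒≗sign-negatives f ±1 v with ±1 v
... | inj₁ fv≡1  rewrite fv≡1  = refl
... | inj₂ fv≡-1 rewrite fv≡-1 = refl

1≤m-k⇔k<m : ∀ m k → + 1 ≤ℤ + m -ℤ + k ⇔ k < m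
1≤m-k⇔k<m m k = mk⇔ to from
  where
  to : + 1 ≤ℤ + m -ℤ + k → k < m
  to 1≤m-k with k <? m
  ... | yes k<m = k<m
  ... | no  k≮m = contradiction (ℤₚ.≤-trans 1≤m-k m-k≤0) λ { (+≤+ ()) }
    where
    m-k≤0 : + m -ℤ + k ≤ℤ + 0
    m-k≤0 = subst₂ _≤ℤ_ (sym (ℤₚ.m-n≡m⊖n m k)) (ℤₚ.n⊖n≡0 k) (ℤₚ.⊖-monoˡ-≤ k (≮⇒≥ k≮m))
  from : k < m → + 1 ≤ℤ + m -ℤ + k
  from k<m = subst (+ 1 ≤ℤ_) (sym (trans (ℤₚ.m-n≡m⊖n m k) (ℤₚ.⊖-≥ (<⇒≤ k<m))))
                   (+≤+ (m<n⇒0<n∸m k<m))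

∧-true : {a b : Bool} → a ∧ b ≡ true → a ≡ true × b ≡ true
∧-true {true} {true} _ = refl , refl

≟-true⇒≡ : {v u : Fin n} → ⌊ v ≟ u ⌋ ≡ true → v ≡ u
≟-true⇒≡ v≟u = toWitness (Equivalence.from Boolₚ.T-≡ v≟u)

≟-refl : (v : Fin n) → ⌊ v ≟ v ⌋ ≡ true
≟-refl v = Equivalence.to Boolₚ.T-≡ (fromWitness refl)

singleton : Fin n → Fin n → Bool
singleton v u = ⌊ v ≟ u ⌋

count-singleton : (v : Fin n) → count (singleton v) ≡ 1
count-singleton v = ≤-antisym
  (count-≤1 (singleton v) λ u w vu vw → trans (sym (≟-true⇒≡ vu)) (≟-true⇒≡ vw))
  (count-≥1 (singleton v) (≟-refl v))

m≤2*[1+m]≤n : ∀ {m n} → 2 * suc m ≤ n → m ≤ n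
m≤2*[1+m]≤n {m} 2+2m≤n = ≤-trans (n≤1+n m) (≤-trans (m≤n*m (suc m) 2) 2+2m≤n)

module _ (G : Graph n) where

  Adj⇒inN : {v u : Fin n} → Adj G v u ≡ true → inN G v u ≡ true
  Adj⇒inN {v} {u} vu = trans (cong (⌊ v ≟ u ⌋ ∨_) vu) (Boolₚ.∨-zeroʳ _)

  inN-refl : (v : Fin n) → inN G v v ≡ true
  inN-refl v = cong (_∨ Adj G v v) (≟-refl v)

  inN-sym : {v u : Fin n} → inN G v u ≡ true → inN G u v ≡ true
  inN-sym {v} {u} vu with v ≟ u
  ... | yes refl = inN-refl v
  ... | no  _    = Adj⇒inN (trans (adj-sym G u v) vu)

  count-closedNbhd : (v : Fin n) → count (inN G v) ≡ suc (degree G v)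
  count-closedNbhd v = begin
    count (inN G v)                         ≡⟨ count-∨-disjoint (singleton v) (Adj G v) loopless ⟩
    count (singleton v) + degree G v         ≡⟨ cong (_+ degree G v) (count-singleton v) ⟩
    suc (degree G v)                        ∎
    where
    open ≡-Reasoning
    loopless : ∀ u → ⌊ v ≟ u ⌋ ∧ Adj G v u ≡ false
    loopless u with v ≟ u
    ... | yes refl = adj-irrefl G v
    ... | no  _    = refl

  singleton-isPacking : (v : Fin n) → IsPacking G (singleton v)
  singleton-isPacking v u w vu vw u≢w _ _ = u≢w (trans (sym (≟-true⇒≡ vu)) (≟-true⇒≡ vw))

  packingNumber-≥1 : {ρ : ℕ} → IsPackingNumber G ρ → Fin n → 1 ≤ ρ
  packingNumber-≥1 (_ , maximal) v =
    ≤-trans (count-≥1 (singleton v) (≟-refl v)) (maximal _ (singleton-isPacking v))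

  packing-closedNbhd-≤1 : {B : Fin n → Bool} → IsPacking G B →
    (v : Fin n) → count (λ u → inN G v u ∧ B u) ≤ 1
  packing-closedNbhd-≤1 {B} packing v = count-≤1 _ unique
    where
    unique : ∀ u w → inN G v u ∧ B u ≡ true → inN G v w ∧ B w ≡ true → u ≡ w
    unique u w vu∧Bu vw∧Bw with u ≟ w | ∧-true vu∧Bu | ∧-true vw∧Bw
    ... | yes u≡w | _ | _ = u≡w
    ... | no  u≢w | vu , Bu | vw , Bw = contradiction (inN-sym vu , inN-sym vw) (packing u w Bu Bw u≢w v)

  packing-∌-neighbour : {B : Fin n → Bool} → IsPacking G B →
    {b u : Fin n} → B b ≡ true → Adj G b u ≡ true → B u ≡ false
  packing-∌-neighbour {B} packing {b} {u} Bb bu with B u in Bu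
  ... | false = refl
  ... | true  = contradiction (Adj⇒inN bu , inN-refl u) (packing b u Bb Bu b≢u u)
    where
    b≢u : b ≢ u
    b≢u refl = contradiction (trans (sym bu) (adj-irrefl G b)) λ ()

  sign-isSDF⇔ : (S : Fin n → Bool) →
    IsSDF G (sign S) ⇔ (∀ v → 2 * count (λ u → inN G v u ∧ S u) ≤ degree G v)
  sign-isSDF⇔ S = mk⇔
    (λ (_ , dominating) v → ≤-pred (Equivalence.to (1≤sum⇔ v) (dominating v)))
    (λ sparse → sign-±1 S , λ v → Equivalence.from (1≤sum⇔ v) (s≤s (sparse v)))
    where
    1≤sum⇔ : ∀ v → + 1 ≤ℤ sumℤ (inN G v) (sign S) ⇔
                     2 * count (λ u → inN G v u ∧ S u) < suc (degree G v)
    1≤sum⇔ v rewrite sumℤ-sign (inN G v) S | count-closedNbhd v = 1≤m-k⇔k<m _ _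

  packing-∨-isSDF : {B T : Fin n → Bool} → IsPacking G B →
    (∀ v → 2 * suc (count T) ≤ degree G v) → IsSDF G (sign (λ u → B u ∨ T u))
  packing-∨-isSDF {B} {T} packing sparse = Equivalence.from (sign-isSDF⇔ _) λ v → ≤-trans
    (*-monoʳ-≤ 2 (begin
      count (λ u → inN G v u ∧ (B u ∨ T u))   ≤⟨ count-mono (drop-inN v) ⟩
      count (λ u → (inN G v u ∧ B u) ∨ T u)   ≤⟨ count-∨-≤ _ T ⟩
      count (λ u → inN G v u ∧ B u) + count T ≤⟨ +-monoˡ-≤ (count T) (packing-closedNbhd-≤1 packing v) ⟩
      suc (count T)                          ∎))
    (sparse v)
    where
    open ≤-Reasoning
    drop-inN : ∀ v u → inN G v u ∧ (B u ∨ T u) ≡ true → (inN G v u ∧ B u) ∨ T u ≡ true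
    drop-inN v u with inN G v u | B u | T u
    ... | true | true  | _ = λ _ → refl
    ... | true | false | _ = id
    ... | false | _    | _ = λ ()

  isSDF-cong : {f g : Fin n → ℤ} → (∀ v → f v ≡ g v) → IsSDF G f → IsSDF G g
  isSDF-cong f≗g (±1 , dominating) =
    (λ v → subst (λ x → x ≡ + 1 ⊎ x ≡ - + 1) (f≗g v) (±1 v)) ,
    (λ v → subst (+ 1 ≤ℤ_) (sumℤ-cong (λ _ → refl) f≗g) (dominating v))

  packing-extension : {B : Fin n → Bool} {b : Fin n} {δ k : ℕ} → IsPacking G B → B b ≡ true →
    (∀ v → δ ≤ degree G v) → 2 * suc k ≤ δ →
    Σ (Fin n → Bool) λ S → IsSDF G (sign S) × count S ≡ count B + k
  packing-extension {B} {b} {δ} {k} packing Bb δ≤deg 2+2k≤δ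
    with T , T⊆Adj , #T ← subset-of-count (Adj G b) k (≤-trans (m≤2*[1+m]≤n 2+2k≤δ) (δ≤deg b)) =
    (λ u → B u ∨ T u) ,
    packing-∨-isSDF packing (λ v → ≤-trans (subst (λ t → 2 * suc t ≤ δ) (sym #T) 2+2k≤δ) (δ≤deg v)) ,
    trans (count-∨-disjoint B T disjoint) (cong₂ _+_ refl #T)
    where
    disjoint : ∀ u → B u ∧ T u ≡ false
    disjoint u with T u in Tu
    ... | false = Boolₚ.∧-zeroʳ (B u)
    ... | true rewrite packing-∌-neighbour packing Bb (T⊆Adj u Tu) = refl

[2*m+n]/2≡m+n/2 : ∀ m n → (2 * m + n) / 2 ≡ m + n / 2
[2*m+n]/2≡m+n/2 m n = trans (+-distrib-/-∣ˡ n (m∣m*n m))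
  (cong (_+ n / 2) (trans (cong (_/ 2) (*-comm 2 m)) (m*n/n≡m m 2)))

bound-≡ : ∀ n ρ {δ} → 2 ≤ δ → bound n ρ δ ≡ + n -ℤ + (2 * (ρ + (δ ∸ 2) / 2))
bound-≡ n ρ {δ} 2≤δ = cong (λ m → + n -ℤ + (2 * m))
  (trans (cong (_/ 2) (+-∸-assoc (2 * ρ) 2≤δ)) ([2*m+n]/2≡m+n/2 ρ (δ ∸ 2)))

2*[1+[n∸2]/2]≤n : ∀ {n} → 2 ≤ n → 2 * suc ((n ∸ 2) / 2) ≤ n
2*[1+[n∸2]/2]≤n {n} 2≤n = subst (λ h → 2 * h ≤ n) (m/n≡1+[m∸n]/n 2≤n)
  (subst (_≤ n) (*-comm (n / 2) 2) (m/n*n≤m n 2))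

2*m≤n⇒m≤n/2 : ∀ {m n} → 2 * m ≤ n → m ≤ n / 2
2*m≤n⇒m≤n/2 {m} {n} 2m≤n =
  subst (_≤ n / 2) (m*n/n≡m m 2) (/-monoˡ-≤ 2 (subst (_≤ n) (*-comm 2 m) 2m≤n))

signedDomNumber-≤-bound : {G : Graph n} {δ ρ : ℕ} {γ : ℤ} →
  IsMinDegree G δ → 2 ≤ δ → IsPackingNumber G ρ → IsSignedDomNumber G γ → γ ≤ℤ bound n ρ δ
signedDomNumber-≤-bound {n} {G} {δ} {ρ} {γ}
  ((v₀ , _) , δ≤deg) 2≤δ ρ-max@((B , packing , #B) , _) (_ , γ-min)
  with b , Bb ← count-≥1⇒∃ B (subst (1 ≤_) (sym #B) (packingNumber-≥1 G ρ-max v₀))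
  with S , S-sdf , #S ← packing-extension G packing Bb δ≤deg (2*[1+[n∸2]/2]≤n 2≤δ)
  = subst (γ ≤ℤ_) weight≡bound (γ-min (sign S) S-sdf)
  where
  k = (δ ∸ 2) / 2
  weight≡bound : weight (sign S) ≡ bound n ρ δ
  weight≡bound = begin
    weight (sign S)                 ≡⟨ weight-sign S ⟩
    + n -ℤ + (2 * count S)          ≡⟨ cong (λ c → + n -ℤ + (2 * c)) (trans #S (cong (_+ k) #B)) ⟩
    + n -ℤ + (2 * (ρ + k))          ≡⟨ bound-≡ n ρ 2≤δ ⟨
    bound n ρ δ                     ∎
    where open ≡-Reasoning

inN-complete : (v u : Fin n) → inN (complete n) v u ≡ true
inN-complete v u with v ≟ u
... | yes _ = refl
... | no  _ = refl

count-closedNbhd-complete : (v : Fin n) (p : Fin n → Bool) →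
  count (λ u → inN (complete n) v u ∧ p u) ≡ count p
count-closedNbhd-complete v p = count-cong (λ u → cong (_∧ p u) (inN-complete v u))

minDegree-complete : {δ : ℕ} → IsMinDegree (complete n) δ → suc δ ≡ n
minDegree-complete {n} {δ} ((v , deg≡δ) , _) = begin
  suc δ                        ≡⟨ cong suc deg≡δ ⟨
  suc (degree (complete n) v)  ≡⟨ count-closedNbhd (complete n) v ⟨
  count (inN (complete n) v)   ≡⟨ count-cong (inN-complete v) ⟩
  count {n} (λ _ → true)       ≡⟨ count-true ⟩
  n                            ∎
  where open ≡-Reasoning

packingNumber-complete : {ρ : ℕ} → IsPackingNumber (complete n) ρ → Fin n → ρ ≡ 1
packingNumber-complete {n} ρ-max@((B , packing , #B) , _) v = ≤-antisym
  (subst (_≤ 1) (trans (count-closedNbhd-complete v B) #B)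
                (packing-closedNbhd-≤1 (complete n) packing v))
  (packingNumber-≥1 (complete n) ρ-max v)

bound-≤-signedDomNumber-complete : {δ ρ : ℕ} {γ : ℤ} →
  IsMinDegree (complete n) δ → 2 ≤ δ → IsPackingNumber (complete n) ρ →
  IsSignedDomNumber (complete n) γ → bound n ρ δ ≤ℤ γ
bound-≤-signedDomNumber-complete {n} {δ} {ρ} {γ}
  ((v , deg≡δ) , _) 2≤δ ρ-max ((f , f-sdf , weight≡γ) , _) = begin
  bound n ρ δ                         ≡⟨ bound-≡ n ρ 2≤δ ⟩
  + n -ℤ + (2 * (ρ + (δ ∸ 2) / 2))    ≡⟨ cong (λ m → + n -ℤ + (2 * m)) ρ+k≡δ/2 ⟩
  + n -ℤ + (2 * (δ / 2))              ≤⟨ ℤₚ.+-monoʳ-≤ (+ n) (ℤₚ.neg-mono-≤ (+≤+ (*-monoʳ-≤ 2 #S≤δ/2))) ⟩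
  + n -ℤ + (2 * count S)              ≡⟨ weight-sign S ⟨
  weight (sign S)                     ≡⟨ sumℤ-cong (λ _ → refl) f≗sign ⟨
  weight f                            ≡⟨ weight≡γ ⟩
  γ                                   ∎
  where
  open ℤₚ.≤-Reasoning
  S = negatives f
  f≗sign : ∀ u → f u ≡ sign S u
  f≗sign = ±1⇒≗sign-negatives f (proj₁ f-sdf)
  ρ+k≡δ/2 : ρ + (δ ∸ 2) / 2 ≡ δ / 2
  ρ+k≡δ/2 = trans (cong (_+ (δ ∸ 2) / 2) (packingNumber-complete ρ-max v))
                  (sym (m/n≡1+[m∸n]/n 2≤δ))
  #S≤δ/2 : count S ≤ δ / 2
  #S≤δ/2 = 2*m≤n⇒m≤n/2 (subst₂ (λ c d → 2 * c ≤ d) (count-closedNbhd-complete v S) deg≡δ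
    (Equivalence.to (sign-isSDF⇔ (complete n) S) (isSDF-cong (complete n) f≗sign f-sdf) v))

theorem2p1 :
    ((n : ℕ) (G : Graph n) (δ ρ : ℕ) (γ : ℤ) →
      Connected G → IsMinDegree G δ → 2 ≤ δ →
      IsPackingNumber G ρ → IsSignedDomNumber G γ →
      γ ≤ℤ bound n ρ δ)
    ×
    ((n : ℕ) → 3 ≤ n → (δ ρ : ℕ) (γ : ℤ) →
      IsMinDegree (complete n) δ → IsPackingNumber (complete n) ρ →
      IsSignedDomNumber (complete n) γ →
      γ ≡ bound n ρ δ)
theorem2p1 =
  (λ n G δ ρ γ _ → signedDomNumber-≤-bound {G = G}) ,
  λ n 3≤n δ ρ γ δ-min ρ-max γ-min →
    let 2≤δ = ≤-pred (subst (3 ≤_) (sym (minDegree-complete δ-min)) 3≤n) in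
    ℤₚ.≤-antisym (signedDomNumber-≤-bound {G = complete n} δ-min 2≤δ ρ-max γ-min)
                 (bound-≤-signedDomNumber-complete δ-min 2≤δ ρ-max γ-min)
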